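{- Let $\sigma\in\mathcal{S}_k$ and $\tau\in\mathcal{S}_n$ with $\sigma\le\tau$ in the pattern poset $\mathcal{P}$. If the pair $(\sigma,\tau)$ has an interval block, then $\mu(\sigma,\tau)=0$, where $\mu$ is the Möbius function of $\mathcal{P}$.
   Context: $\mathcal{P}$ is the poset of all permutations (of $\{1,\dots,m\}$ for all $m\ge1$) ordered by pattern containment: $\sigma\le\tau$ if some subsequence $\tau(i_1)\cdots\tau(i_k)$ ($i_1<\dots<i_k$) is order isomorphic to $\sigma$ (has letters in the same relative order of size); such a subsequence is an occurrence of $\sigma$ in $\tau$. An interval block of $\tau$ is a factor (consecutive substring) $\tau(a)\tau(a+1)\cdots\tau(a+b)$ with $b\ge1$ whose set of values is $\{a',a'+1,\dots,a'+b\}$ for some $a'$. The pair $(\sigma,\tau)$ has an interval block if $\tau$ has an interval block that is disjoint from (shares no letter with) every occurrence of $\sigma$ in $\tau$. The Möbius function is defined by $\mu(s,s)=1$ and $\mu(s,t)=-\sum_{s\le x<t}\mu(s,x)$ for $s<t$. -}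

module Defs where

open import Data.Nat using (ℕ; suc; _≤_; _<_)
open import Data.Fin using (Fin; toℕ)
import Data.Fin.Properties as FinP
open import Data.Vec using (Vec; lookup; toList)
open import Data.Bool using (T)
open import Data.List using (List; map; foldr)
open import Data.Product using (Σ; ∃; _×_; _,_; proj₁)
open import Data.Integer using (ℤ; -_; _+_) renaming (+_ to pos)
open import Data.Nat using () renaming (_+_ to _+ℕ_)
open import Data.Empty using (⊥)
open import Relation.Nullary using (¬_; does)
open import Relation.Binary.PropositionalEquality using (_≡_)
open import Data.List.Membership.Propositional using (_∈_)
open import Data.List.Relation.Unary.Unique.Propositional using (Unique)
import Data.List.Relation.Unary.Unique.DecPropositional as UDec
open import Function.Bundles using (_⇔_)

-- Permutations of size m, in one-line notation, 0-based values:
-- a vector of length m over Fin m with pairwise distinct entries.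
-- The distinctness is a boolean check, so the proof component is
-- (definitionally) unique and _≡_ on Perm is equality of the words.

isPerm : ∀ {m} → Vec (Fin m) m → Set
isPerm {m} v = T (does (UDec.unique? FinP._≟_ (toList v)))

Perm : ℕ → Set
Perm m = Σ (Vec (Fin m) m) isPerm

_!_ : ∀ {m} → Perm m → Fin m → Fin m
σ ! i = lookup (proj₁ σ) i

-- Elements of the pattern poset 𝒫: permutations of any size m ≥ 1,
-- stored as m = suc size.
record Elem : Set where
  constructor ⟨_,_⟩
  field
    size : ℕ
    perm : Perm (suc size)
open Elem public

record Occurrence {k n : ℕ} (σ : Perm k) (τ : Perm n) : Set where
  field
    position   : Fin k → Fin n
    increasing : ∀ i j → toℕ i < toℕ j → toℕ (position i) < toℕ (position j)
    orderIso   : ∀ i j → (toℕ (σ ! i) < toℕ (σ ! j)) ⇔ (toℕ (τ ! position i) < toℕ (τ ! position j))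
open Occurrence public

_≼_ : ∀ {k n} → Perm k → Perm n → Set
σ ≼ τ = Occurrence σ τ

_≤𝒫_ : Elem → Elem → Set
s ≤𝒫 t = perm s ≼ perm t

_<𝒫_ : Elem → Elem → Set
s <𝒫 t = (s ≤𝒫 t) × ¬ (s ≡ t)

-- Interval blocks (0-based positions).
-- Positions a, a+1, ..., a+b (b ≥ 1) form a factor of τ whose set of
-- values is exactly {a', a'+1, ..., a'+b}.

InBlock : ℕ → ℕ → ℕ → Set
InBlock a b p = (a ≤ p) × (p ≤ a +ℕ b)

record IntervalBlock {n : ℕ} (τ : Perm n) : Set where
  field
    start  : ℕ
    len    : ℕ
    len≥1  : 1 ≤ len
    fits   : start +ℕ len < n
    low    : ℕ
    valuesIn  : ∀ (p : Fin n) → InBlock start len (toℕ p) →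
                  InBlock low len (toℕ (τ ! p))
    valuesAll : ∀ (v : ℕ) → InBlock low len v →
                  ∃ λ (p : Fin n) → InBlock start len (toℕ p) × (toℕ (τ ! p) ≡ v)
open IntervalBlock public

DisjointFrom : ∀ {k n} {σ : Perm k} {τ : Perm n} →
               IntervalBlock τ → Occurrence σ τ → Set
DisjointFrom B occ = ∀ i → ¬ InBlock (start B) (len B) (toℕ (position occ i))

HasIntervalBlock : ∀ {k n} → Perm k → Perm n → Set
HasIntervalBlock {k} {n} σ τ =
  Σ (IntervalBlock τ) λ B → (occ : Occurrence σ τ) → DisjointFrom B occ

-- The (finite) sum over the interval [s,t) is expressed as the sum over
-- any duplicate-free list enumerating exactly that interval.

EnumeratesHalfOpen : Elem → Elem → List Elem → Set
EnumeratesHalfOpen s t L =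
  Unique L × (∀ x → (x ∈ L) ⇔ ((s ≤𝒫 x) × (x <𝒫 t)))

sumℤ : List ℤ → ℤ
sumℤ = foldr _+_ (pos 0)

IsMobius : (Elem → Elem → ℤ) → Set
IsMobius μ =
  (∀ s → μ s s ≡ pos 1) ×
  (∀ s t → s <𝒫 t → ∀ L → EnumeratesHalfOpen s t L →
     μ s t ≡ - sumℤ (map (μ s) L))

-- View the interval block as a set I of positions of τ that is an interval both in positions
-- and in values, contains two positions q ≠ q′ and meets no occurrence of σ. Let ρ be τ with
-- the letter at q deleted, so that σ < ρ < τ. In μ(σ,τ) = −Σ_{σ≤x<τ} μ(σ,x) the terms with
-- x ≤ ρ add up to Σ_{σ≤x≤ρ} μ(σ,x) = 0. Any other x < τ only has occurrences in τ that meet I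
-- in at least two letters, since an occurrence meeting I at most once can be moved off q (onto
-- q′) and then lies in ρ. So I pulls back to such a block of x, and μ(σ,x) = 0 by induction on
-- the size of x.

module Submission where

open import Defs

open import Data.Bool using (T?)
open import Data.Bool.Properties using (T-irrelevant)
open import Data.Empty using (⊥-elim)
open import Data.Fin as Fin using (Fin; toℕ; opposite; punchIn; punchOut; inject₁)
import Data.Fin.Induction as Fin
import Data.Fin.Properties as Fin
open import Data.Integer using (ℤ; -_; _+_; 0ℤ) renaming (+_ to pos)
import Data.Integer.Properties as ℤ
open import Algebra.Properties.CommutativeSemigroup ℤ.+-commutativeSemigroup using (x∙yz≈y∙xz)
open import Data.List as List using (List; []; _∷_; [_]; filter)
import Data.List.Properties as List
open import Data.List.Membership.Propositional using (_∈_)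
import Data.List.Membership.Propositional.Properties as ∈
open import Data.List.Relation.Unary.All as All using (All; []; _∷_)
import Data.List.Relation.Unary.AllPairs as AllPairs
open import Data.List.Relation.Unary.Any as Any using (Any; here; there)
import Data.List.Relation.Unary.Unique.DecPropositional as UniqueDec
import Data.List.Relation.Unary.Unique.DecPropositional.Properties as UniqueDecₚ
open import Data.List.Relation.Unary.Unique.Propositional using (Unique)
import Data.List.Relation.Unary.Unique.Propositional.Properties as Unique
open import Data.Nat as ℕ using (ℕ; zero; suc; z≤n; s≤s; _≤_; _<_)
open import Data.Nat.Induction using (<-rec)
import Data.Nat.Properties as ℕ
open import Data.Product using (Σ; ∃; _×_; _,_; proj₁; proj₂)
open import Data.Sum using (_⊎_; inj₁; inj₂)
open import Data.Vec as Vec using (Vec; lookup; toList; tabulate)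
open import Data.Vec.Membership.Propositional.Properties using (∈-lookup; ∈-toList⁺)
import Data.Vec.Properties as Vec
open import Function using (_∘_; id)
open import Function.Bundles using (_⇔_; mk⇔; Equivalence)
open import Function.Construct.Composition using (_⇔-∘_)
open import Function.Construct.Identity using (⇔-id)
open import Function.Construct.Symmetry using (⇔-sym)
open import Function.Definitions using (Injective)
open import Relation.Binary.Definitions using (DecidableEquality; tri<; tri≈; tri>)
open import Relation.Binary.PropositionalEquality
  using (_≡_; _≢_; refl; sym; trans; cong; cong₂; subst; subst₂; module ≡-Reasoning)
open import Relation.Nullary using (¬_; Dec; yes; no; contradiction; ¬?)
open import Relation.Nullary.Decidable as Dec using (_×-dec_; _→-dec_)
open import Relation.Unary using (Decidable)

private variable
  k m n : ℕ

unique⇒lookup-injective : ∀ {A : Set} (v : Vec A m) → Unique (toList v) →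
                          Injective _≡_ _≡_ (lookup v)
unique⇒lookup-injective (x Vec.∷ v) _ {Fin.zero} {Fin.zero} _ = refl
unique⇒lookup-injective (x Vec.∷ v) (x∉v AllPairs.∷ _) {Fin.zero} {Fin.suc j} eq =
  ⊥-elim (All.lookup x∉v (∈-toList⁺ (∈-lookup j v)) eq)
unique⇒lookup-injective (x Vec.∷ v) (x∉v AllPairs.∷ _) {Fin.suc i} {Fin.zero} eq =
  ⊥-elim (All.lookup x∉v (∈-toList⁺ (∈-lookup i v)) (sym eq))
unique⇒lookup-injective (x Vec.∷ v) (_ AllPairs.∷ v-unique) {Fin.suc i} {Fin.suc j} eq =
  cong Fin.suc (unique⇒lookup-injective v v-unique eq)

isPerm⇔unique : (v : Vec (Fin m) m) → isPerm v ⇔ Unique (toList v)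
isPerm⇔unique v with UniqueDec.unique? Fin._≟_ (toList v)
... | yes u = mk⇔ (λ _ → u) _
... | no ¬u = mk⇔ (λ ()) ¬u

!-injective : (τ : Perm m) → Injective _≡_ _≡_ (τ !_)
!-injective (v , p) = unique⇒lookup-injective v (Equivalence.to (isPerm⇔unique v) p)

toList-tabulate : ∀ {A : Set} (f : Fin m → A) → toList (tabulate f) ≡ List.tabulate f
toList-tabulate {zero} f = refl
toList-tabulate {suc m} f = cong (f Fin.zero List.∷_) (toList-tabulate (f ∘ Fin.suc))

fromInjection : (f : Fin m → Fin m) → Injective _≡_ _≡_ f → Perm m
fromInjection f f-inj = tabulate f , Equivalence.from (isPerm⇔unique (tabulate f))
  (subst Unique (sym (toList-tabulate f)) (Unique.tabulate⁺ f-inj))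

fromInjection-! : ∀ (f : Fin m → Fin m) (f-inj : Injective _≡_ _≡_ f) i →
                  fromInjection f f-inj ! i ≡ f i
fromInjection-! f _ = Vec.lookup∘tabulate f

perm-ext : (π ρ : Perm m) → (∀ i → π ! i ≡ ρ ! i) → π ≡ ρ
perm-ext (v , p) (w , q) eq
  with trans (sym (Vec.tabulate∘lookup v)) (trans (Vec.tabulate-cong eq) (Vec.tabulate∘lookup w))
... | refl = cong (v ,_) (T-irrelevant p q)

perm-≟ : DecidableEquality (Perm m)
perm-≟ (v , p) (w , q) with Vec.≡-dec Fin._≟_ v w
... | yes refl = yes (cong (v ,_) (T-irrelevant p q))
... | no v≢w = no (v≢w ∘ cong proj₁)

elem-≟ : DecidableEquality Elem
elem-≟ ⟨ a , π ⟩ ⟨ b , ρ ⟩ with a ℕ.≟ b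
... | no a≢b = no (a≢b ∘ cong size)
... | yes refl with perm-≟ π ρ
...   | yes refl = yes refl
...   | no π≢ρ = no λ { refl → π≢ρ refl }

Increasing : (Fin m → Fin n) → Set
Increasing f = ∀ i j → toℕ i < toℕ j → toℕ (f i) < toℕ (f j)

increasing⇒injective : ∀ {f : Fin m → Fin n} → Increasing f → Injective _≡_ _≡_ f
increasing⇒injective inc {i} {j} fi≡fj with ℕ.<-cmp (toℕ i) (toℕ j)
... | tri< i<j _ _ = contradiction (inc i j i<j) (ℕ.<-irrefl (cong toℕ fi≡fj))
... | tri≈ _ i≡j _ = Fin.toℕ-injective i≡j
... | tri> _ _ j<i = contradiction (inc j i j<i) (ℕ.<-irrefl (cong toℕ (sym fi≡fj)))

increasing⇒reflects-< : ∀ {f : Fin m → Fin n} → Increasing f →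
                        ∀ i j → toℕ (f i) < toℕ (f j) → toℕ i < toℕ j
increasing⇒reflects-< {f = f} inc i j fi<fj with ℕ.<-cmp (toℕ i) (toℕ j)
... | tri< i<j _ _ = i<j
... | tri≈ _ i≡j _ = contradiction fi<fj (ℕ.<-irrefl (cong (toℕ ∘ f) (Fin.toℕ-injective i≡j)))
... | tri> _ _ j<i = contradiction (inc j i j<i) (ℕ.<-asym fi<fj)

increasing⇒≤ : ∀ {f : Fin m → Fin n} → Increasing f → ∀ i → toℕ i ≤ toℕ (f i)
increasing⇒≤ {suc m} {f = f} inc = Fin.<-weakInduction (λ i → toℕ i ≤ toℕ (f i)) z≤n step
  where
  step : ∀ i → toℕ (inject₁ i) ≤ toℕ (f (inject₁ i)) → toℕ i < toℕ (f (Fin.suc i))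
  step i ih = ℕ.≤-<-trans (subst (_≤ toℕ (f (inject₁ i))) (Fin.toℕ-inject₁ i) ih)
                          (inc (inject₁ i) (Fin.suc i) (s≤s (ℕ.≤-reflexive (Fin.toℕ-inject₁ i))))

opposite-< : ∀ {i j : Fin n} → toℕ i < toℕ j → toℕ (opposite j) < toℕ (opposite i)
opposite-< {i = i} {j} i<j rewrite Fin.opposite-prop i | Fin.opposite-prop j =
  ℕ.∸-monoʳ-< (s≤s i<j) (Fin.toℕ<n j)

-- Reflecting f by opposite turns the lower bound toℕ i ≤ toℕ (f i) into an upper bound.
increasing⇒id : ∀ {f : Fin m → Fin m} → Increasing f → ∀ i → f i ≡ i
increasing⇒id {f = f} inc i =
  Fin.toℕ-injective (ℕ.≤-antisym (ℕ.≮⇒≥ i≮fi) (increasing⇒≤ inc i))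
  where
  reflected-increasing : Increasing (opposite ∘ f ∘ opposite)
  reflected-increasing i j i<j = opposite-< (inc _ _ (opposite-< i<j))

  opposite-bound : toℕ (opposite i) ≤ toℕ (opposite (f i))
  opposite-bound = subst (λ j → toℕ (opposite i) ≤ toℕ (opposite (f j))) (Fin.opposite-involutive i)
                         (increasing⇒≤ reflected-increasing (opposite i))

  i≮fi : ¬ toℕ i < toℕ (f i)
  i≮fi i<fi = ℕ.<⇒≱ (opposite-< i<fi) opposite-bound

injective⇒surjective : ∀ {f : Fin m → Fin m} → Injective _≡_ _≡_ f → ∀ v → ∃ λ i → f i ≡ v
injective⇒surjective {suc m} {f} f-inj v with Fin.any? (λ i → f i Fin.≟ v)
... | yes hit = hit
... | no miss = contradiction (Fin.injective⇒≤ squeezed-injective) ℕ.1+n≰n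
  where
  v≢f : ∀ i → v ≢ f i
  v≢f i v≡fi = miss (i , sym v≡fi)

  squeezed-injective : Injective _≡_ _≡_ (λ i → punchOut (v≢f i))
  squeezed-injective eq = f-inj (Fin.punchOut-injective (v≢f _) (v≢f _) eq)

value : Perm n → Fin n → ℕ
value τ p = toℕ (τ ! p)

value-injective : (τ : Perm n) → Injective _≡_ _≡_ (value τ)
value-injective τ = !-injective τ ∘ Fin.toℕ-injective

OrderIsomorphic : Perm k → Perm n → (Fin k → Fin n) → Set
OrderIsomorphic σ τ f = ∀ i j → (value σ i < value σ j) ⇔ (value τ (f i) < value τ (f j))

increasing-cong : ∀ {f g : Fin k → Fin n} → (∀ i → f i ≡ g i) → Increasing f → Increasing g
increasing-cong f≗g inc i j i<j rewrite sym (f≗g i) | sym (f≗g j) = inc i j i<j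

orderIsomorphic-cong : ∀ (σ : Perm k) (τ : Perm n) {f g} → (∀ i → f i ≡ g i) →
                       OrderIsomorphic σ τ f → OrderIsomorphic σ τ g
orderIsomorphic-cong _ _ f≗g iso i j rewrite sym (f≗g i) | sym (f≗g j) = iso i j

≼-refl : (σ : Perm k) → σ ≼ σ
≼-refl σ = record { position = id ; increasing = λ _ _ i<j → i<j ; orderIso = λ _ _ → ⇔-id _ }

≼-trans : ∀ {σ : Perm k} {ρ : Perm m} {τ : Perm n} → σ ≼ ρ → ρ ≼ τ → σ ≼ τ
≼-trans σρ ρτ = record
  { position   = position ρτ ∘ position σρ
  ; increasing = λ i j i<j → increasing ρτ _ _ (increasing σρ i j i<j)
  ; orderIso   = λ i j → orderIso ρτ _ _ ⇔-∘ orderIso σρ i j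
  }

≼-factor : ∀ {x : Perm k} {ρ : Perm m} {τ : Perm n} (D : ρ ≼ τ) (E : x ≼ τ) (f : Fin k → Fin m) →
           (∀ i → position D (f i) ≡ position E i) → x ≼ ρ
≼-factor {x = x} {τ = τ} D E f D∘f≗E = record
  { position   = f
  ; increasing = λ i j i<j → increasing⇒reflects-< (increasing D) (f i) (f j) (D∘f-increasing i j i<j)
  ; orderIso   = λ i j → ⇔-sym (orderIso D (f i) (f j)) ⇔-∘ D∘f-orderIso i j
  }
  where
  D∘f-increasing : Increasing (position D ∘ f)
  D∘f-increasing = increasing-cong (sym ∘ D∘f≗E) (increasing E)
  D∘f-orderIso : OrderIsomorphic x τ (position D ∘ f)
  D∘f-orderIso = orderIsomorphic-cong x τ (sym ∘ D∘f≗E) (orderIso E)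

≼⇒≤ : ∀ {σ : Perm k} {τ : Perm n} → σ ≼ τ → k ≤ n
≼⇒≤ occ = Fin.injective⇒≤ (increasing⇒injective (increasing occ))

-- π ∘ τ⁻¹ is an increasing endomap of Fin m, hence the identity.
≼-sameSize⇒≡ : ∀ {π τ : Perm m} → π ≼ τ → π ≡ τ
≼-sameSize⇒≡ {π = π} {τ} occ = perm-ext π τ λ i →
  trans (cong (π !_) (sym (τ⁻¹∘τ i))) (increasing⇒id π∘τ⁻¹-increasing (τ ! i))
  where
  τ⁻¹ : Fin _ → Fin _
  τ⁻¹ v = proj₁ (injective⇒surjective (!-injective τ) v)

  τ∘τ⁻¹ : ∀ v → τ ! τ⁻¹ v ≡ v
  τ∘τ⁻¹ v = proj₂ (injective⇒surjective (!-injective τ) v)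

  τ⁻¹∘τ : ∀ i → τ⁻¹ (τ ! i) ≡ i
  τ⁻¹∘τ i = !-injective τ (τ∘τ⁻¹ (τ ! i))

  π-τ-orderIsomorphic : OrderIsomorphic π τ id
  π-τ-orderIsomorphic = orderIsomorphic-cong π τ (increasing⇒id (increasing occ)) (orderIso occ)

  π∘τ⁻¹-increasing : Increasing (λ v → π ! τ⁻¹ v)
  π∘τ⁻¹-increasing u w u<w = Equivalence.from (π-τ-orderIsomorphic (τ⁻¹ u) (τ⁻¹ w))
    (subst₂ (λ a b → toℕ a < toℕ b) (sym (τ∘τ⁻¹ u)) (sym (τ∘τ⁻¹ w)) u<w)

≼-missing⇒≢ : ∀ {σ : Perm (suc k)} {ρ : Perm (suc m)} (occ : σ ≼ ρ) (z : Fin (suc m)) →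
              (∀ i → position occ i ≢ z) → ⟨ k , σ ⟩ ≢ ⟨ m , ρ ⟩
≼-missing⇒≢ occ z misses refl = misses z (increasing⇒id (increasing occ) z)

≤𝒫⇒size≤ : ∀ {x t} → x ≤𝒫 t → size x ≤ size t
≤𝒫⇒size≤ = ℕ.s≤s⁻¹ ∘ ≼⇒≤

<𝒫⇒size< : ∀ {x t} → x <𝒫 t → size x < size t
<𝒫⇒size< {⟨ a , π ⟩} {⟨ b , τ ⟩} (π≼τ , x≢t) with ℕ.m≤n⇒m<n∨m≡n (≤𝒫⇒size≤ π≼τ)
... | inj₁ a<b  = a<b
... | inj₂ refl = contradiction (cong ⟨ a ,_⟩ (≼-sameSize⇒≡ π≼τ)) x≢t

≤𝒫-<𝒫-trans : ∀ {x r t} → x ≤𝒫 r → r <𝒫 t → x <𝒫 t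
≤𝒫-<𝒫-trans x≤r r<t =
  ≼-trans x≤r (proj₁ r<t) , λ { refl → ℕ.<⇒≱ (<𝒫⇒size< r<t) (≤𝒫⇒size≤ x≤r) }

≤⇔≤⇒>⇔> : ∀ {a b c d : ℕ} → (a ≤ b) ⇔ (c ≤ d) → (b < a) ⇔ (d < c)
≤⇔≤⇒>⇔> a≤b⇔c≤d = mk⇔ (λ b<a → ℕ.≰⇒> (ℕ.<⇒≱ b<a ∘ Equivalence.from a≤b⇔c≤d))
                        (λ d<c → ℕ.≰⇒> (ℕ.<⇒≱ d<c ∘ Equivalence.to a≤b⇔c≤d))

punchIn-<⇔ : ∀ (q : Fin (suc n)) i j → (toℕ i < toℕ j) ⇔ (toℕ (punchIn q i) < toℕ (punchIn q j))
punchIn-<⇔ q i j = ≤⇔≤⇒>⇔> (mk⇔ (Fin.punchIn-mono-≤ q j i) (Fin.punchIn-cancel-≤ q j i))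

punchOut-<⇔ : ∀ {q i j : Fin (suc n)} (q≢i : q ≢ i) (q≢j : q ≢ j) →
              (toℕ i < toℕ j) ⇔ (toℕ (punchOut q≢i) < toℕ (punchOut q≢j))
punchOut-<⇔ q≢i q≢j = ≤⇔≤⇒>⇔> (mk⇔ (Fin.punchOut-mono-≤ q≢j q≢i) (Fin.punchOut-cancel-≤ q≢j q≢i))

module _ (τ : Perm (suc n)) (q : Fin (suc n)) where

  private
    τq≢τ∘punchIn : ∀ i → τ ! q ≢ τ ! punchIn q i
    τq≢τ∘punchIn i eq = Fin.punchInᵢ≢i q i (sym (!-injective τ eq))

    deleted : Fin n → Fin n
    deleted i = punchOut (τq≢τ∘punchIn i)

    deleted-injective : Injective _≡_ _≡_ deleted
    deleted-injective eq = Fin.punchIn-injective q _ _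
      (!-injective τ (Fin.punchOut-injective (τq≢τ∘punchIn _) (τq≢τ∘punchIn _) eq))

  -- τ with the letter at position q removed, standardized.
  delete : Perm n
  delete = fromInjection deleted deleted-injective

  delete-≼ : delete ≼ τ
  delete-≼ = record
    { position   = punchIn q
    ; increasing = λ i j → Equivalence.to (punchIn-<⇔ q i j)
    ; orderIso   = λ i j → ⇔-sym (punchOut-<⇔ (τq≢τ∘punchIn i) (τq≢τ∘punchIn j)) ⇔-∘ values i j
    }
    where
    values : ∀ i j → (value delete i < value delete j) ⇔ (toℕ (deleted i) < toℕ (deleted j))
    values i j rewrite fromInjection-! deleted deleted-injective i
                     | fromInjection-! deleted deleted-injective j = ⇔-id _

  ≼-delete : ∀ {x : Perm k} (E : x ≼ τ) → (∀ i → position E i ≢ q) → x ≼ delete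
  ≼-delete E misses = ≼-factor delete-≼ E (λ i → punchOut (misses i ∘ sym))
                               (λ i → Fin.punchIn-punchOut (misses i ∘ sym))

increasing? : (f : Fin k → Fin n) → Dec (Increasing f)
increasing? f = Fin.all? λ i → Fin.all? λ j → toℕ i ℕ.<? toℕ j →-dec toℕ (f i) ℕ.<? toℕ (f j)

⇔-dec : ∀ {A B : Set} → Dec A → Dec B → Dec (A ⇔ B)
⇔-dec a? b? = Dec.map′ (λ (f , g) → mk⇔ f g) (λ e → Equivalence.to e , Equivalence.from e)
                       ((a? →-dec b?) ×-dec (b? →-dec a?))

orderIsomorphic? : (σ : Perm k) (τ : Perm n) (f : Fin k → Fin n) → Dec (OrderIsomorphic σ τ f)
orderIsomorphic? σ τ f = Fin.all? λ i → Fin.all? λ j →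
  ⇔-dec (value σ i ℕ.<? value σ j) (value τ (f i) ℕ.<? value τ (f j))

allVectors : ∀ k n → List (Vec (Fin n) k)
allVectors zero    n = [ Vec.[] ]
allVectors (suc k) n = List.cartesianProductWith Vec._∷_ (List.allFin n) (allVectors k n)

∈-allVectors : (v : Vec (Fin n) k) → v ∈ allVectors k n
∈-allVectors Vec.[]       = here refl
∈-allVectors (x Vec.∷ v) = ∈.∈-cartesianProductWith⁺ Vec._∷_ (∈.∈-allFin x) (∈-allVectors v)

_≼?_ : (σ : Perm k) (τ : Perm n) → Dec (σ ≼ τ)
_≼?_ {k} {n} σ τ = Dec.map′ fromVector toVector (Any.any? IsPositionVector? (allVectors k n))
  where
  IsPositionVector : Vec (Fin n) k → Set
  IsPositionVector v = Increasing (lookup v) × OrderIsomorphic σ τ (lookup v)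

  IsPositionVector? : Decidable IsPositionVector
  IsPositionVector? v = increasing? (lookup v) ×-dec orderIsomorphic? σ τ (lookup v)

  fromVector : Any IsPositionVector (allVectors k n) → σ ≼ τ
  fromVector hit with _ , inc , iso ← Any.satisfied hit =
    record { position = _ ; increasing = inc ; orderIso = iso }

  toVector : σ ≼ τ → Any IsPositionVector (allVectors k n)
  toVector occ = Any.map (λ { refl → increasing-cong e≗v (increasing occ)
                                   , orderIsomorphic-cong σ τ e≗v (orderIso occ) })
                         (∈-allVectors (tabulate (position occ)))
    where
    e≗v : ∀ i → position occ i ≡ lookup (tabulate (position occ)) i
    e≗v i = sym (Vec.lookup∘tabulate (position occ) i)

_≤𝒫?_ : (s t : Elem) → Dec (s ≤𝒫 t)
s ≤𝒫? t = perm s ≼? perm t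

_<𝒫?_ : (s t : Elem) → Dec (s <𝒫 t)
s <𝒫? t = (s ≤𝒫? t) ×-dec ¬? (elem-≟ s t)

isPerm? : (v : Vec (Fin m) m) → Dec (isPerm v)
isPerm? v = T? _

perms : List (Vec (Fin m) m) → List (Perm m)
perms [] = []
perms (v ∷ vs) with isPerm? v
... | yes p = (v , p) ∷ perms vs
... | no _  = perms vs

∈-perms : ∀ {vs} {v : Vec (Fin m) m} (p : isPerm v) → v ∈ vs → (v , p) ∈ perms vs
∈-perms {vs = w ∷ _} p (here refl) with isPerm? w
... | yes p′ = here (cong (w ,_) (T-irrelevant p p′))
... | no ¬p  = contradiction p ¬p
∈-perms {vs = w ∷ _} p (there v∈vs) with isPerm? w
... | yes _ = there (∈-perms p v∈vs)
... | no _  = ∈-perms p v∈vs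

elemsOfSize : ℕ → List Elem
elemsOfSize s = List.map ⟨ s ,_⟩ (perms (allVectors (suc s) (suc s)))

elemsUpTo : ℕ → List Elem
elemsUpTo N = List.concatMap elemsOfSize (List.upTo (suc N))

∈-elemsUpTo : ∀ {N} (x : Elem) → size x ≤ N → x ∈ elemsUpTo N
∈-elemsUpTo ⟨ s , (v , p) ⟩ s≤N =
  ∈.∈-concat⁺′ (∈.∈-map⁺ ⟨ s ,_⟩ (∈-perms p (∈-allVectors v)))
               (∈.∈-map⁺ elemsOfSize (∈.∈-upTo⁺ (s≤s s≤N)))

halfOpenInterval : ∀ s t → Σ (List Elem) (EnumeratesHalfOpen s t)
halfOpenInterval s t = L , UniqueDecₚ.deduplicate-! elem-≟ candidates , λ x →
  mk⇔ (proj₂ ∘ ∈.∈-filter⁻ inInterval? ∘ ∈.∈-deduplicate⁻ elem-≟ candidates)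
      (λ x-in → ∈.∈-deduplicate⁺ elem-≟
        (∈.∈-filter⁺ inInterval? (∈-elemsUpTo x (≤𝒫⇒size≤ (proj₁ (proj₂ x-in)))) x-in))
  where
  inInterval? : ∀ x → Dec ((s ≤𝒫 x) × (x <𝒫 t))
  inInterval? x = (s ≤𝒫? x) ×-dec (x <𝒫? t)

  candidates : List Elem
  candidates = filter inInterval? (elemsUpTo (size t))

  L : List Elem
  L = List.deduplicate elem-≟ candidates

sumMap : ∀ {A : Set} → (A → ℤ) → List A → ℤ
sumMap f xs = sumℤ (List.map f xs)

module _ {A : Set} (f : A → ℤ) where

  sumMap-filter : ∀ {P : A → Set} (P? : Decidable P) xs →
                  sumMap f xs ≡ sumMap f (filter P? xs) + sumMap f (filter (λ x → ¬? (P? x)) xs)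
  sumMap-filter P? [] = refl
  sumMap-filter P? (x ∷ xs) with P? x
  ... | yes _ = trans (cong (f x +_) (sumMap-filter P? xs)) (sym (ℤ.+-assoc (f x) _ _))
  ... | no _  = trans (cong (f x +_) (sumMap-filter P? xs))
                      (x∙yz≈y∙xz (f x) (sumMap f (filter P? xs)) (sumMap f (filter (λ x → ¬? (P? x)) xs)))

  sumMap-remove : (_≟_ : DecidableEquality A) → ∀ {xs y} → Unique xs → y ∈ xs →
                  sumMap f xs ≡ f y + sumMap f (filter (λ x → ¬? (x ≟ y)) xs)
  sumMap-remove _≟_ {y ∷ xs} (y∉xs AllPairs.∷ _) (here refl)
    rewrite List.filter-reject (λ x → ¬? (x ≟ y)) {x = y} {xs = xs} (λ y≢y → y≢y refl)
          | List.filter-all (λ x → ¬? (x ≟ y)) (All.map (λ y≢x x≡y → y≢x (sym x≡y)) y∉xs) = refl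
  sumMap-remove _≟_ {x ∷ xs} {y} (x∉xs AllPairs.∷ xs-unique) (there y∈xs)
    rewrite List.filter-accept (λ x → ¬? (x ≟ y)) {x = x} {xs = xs} (All.lookup x∉xs y∈xs) =
    trans (cong (f x +_) (sumMap-remove _≟_ xs-unique y∈xs)) (x∙yz≈y∙xz (f x) (f y) _)

  sumMap-zero : ∀ {xs} → All (λ x → f x ≡ 0ℤ) xs → sumMap f xs ≡ 0ℤ
  sumMap-zero [] = refl
  sumMap-zero (fx≡0 ∷ fxs≡0) rewrite fx≡0 | sumMap-zero fxs≡0 = refl

Convex : (Fin n → ℕ) → (Fin n → Set) → Set
Convex f I = ∀ {a b c} → I a → I b → f a < f c → f c < f b → I c

SameSide : (Fin n → ℕ) → Fin n → Fin n → Fin n → Set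
SameSide f c a b = ((f c < f a) ⇔ (f c < f b)) × ((f a < f c) ⇔ (f b < f c))

module _ {f : Fin n → ℕ} {I : Fin n → Set} (f-injective : Injective _≡_ _≡_ f) (convex : Convex f I) where

  convex-below : ∀ {a b c} → I a → I b → ¬ I c → f c < f a → f c < f b
  convex-below {a} {b} {c} Ia Ib ¬Ic c<a with ℕ.<-cmp (f c) (f b)
  ... | tri< c<b _ _ = c<b
  ... | tri≈ _ c≡b _ = contradiction (subst I (sym (f-injective c≡b)) Ib) ¬Ic
  ... | tri> _ _ b<c = contradiction (convex Ib Ia b<c c<a) ¬Ic

  convex-above : ∀ {a b c} → I a → I b → ¬ I c → f a < f c → f b < f c
  convex-above {a} {b} {c} Ia Ib ¬Ic a<c with ℕ.<-cmp (f b) (f c)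
  ... | tri< b<c _ _ = b<c
  ... | tri≈ _ b≡c _ = contradiction (subst I (f-injective b≡c) Ib) ¬Ic
  ... | tri> _ _ c<b = contradiction (convex Ia Ib a<c c<b) ¬Ic

  convex-sameSide : ∀ {a b c} → I a → I b → ¬ I c → SameSide f c a b
  convex-sameSide Ia Ib ¬Ic = mk⇔ (convex-below Ia Ib ¬Ic) (convex-below Ib Ia ¬Ic)
                            , mk⇔ (convex-above Ia Ib ¬Ic) (convex-above Ib Ia ¬Ic)

replaceAt : (Fin k → Fin n) → Fin k → Fin n → Fin k → Fin n
replaceAt e i₀ q′ i with i Fin.≟ i₀
... | yes _ = q′
... | no _  = e i

replaceAt-<⇔ : ∀ (f : Fin n → ℕ) (e : Fin k → Fin n) i₀ q′ →
               (∀ j → j ≢ i₀ → SameSide f (e j) (e i₀) q′) →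
               ∀ i j → (f (e i) < f (e j)) ⇔ (f (replaceAt e i₀ q′ i) < f (replaceAt e i₀ q′ j))
replaceAt-<⇔ f e i₀ q′ sameSide i j with i Fin.≟ i₀ | j Fin.≟ i₀
... | yes refl | yes refl = mk⇔ (λ p<p → contradiction p<p (ℕ.<-irrefl refl))
                                (λ p<p → contradiction p<p (ℕ.<-irrefl refl))
... | yes refl | no j≢i₀  = proj₂ (sameSide j j≢i₀)
... | no i≢i₀  | yes refl = proj₁ (sameSide i i≢i₀)
... | no _     | no _     = ⇔-id _

reroute : ∀ {x : Perm k} {τ : Perm n} (E : x ≼ τ) (i₀ : Fin k) (q′ : Fin n) →
          (∀ j → j ≢ i₀ → SameSide toℕ (position E j) (position E i₀) q′) →
          (∀ j → j ≢ i₀ → SameSide (value τ) (position E j) (position E i₀) q′) → x ≼ τ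
reroute {τ = τ} E i₀ q′ samePosition sameValue = record
  { position   = replaceAt (position E) i₀ q′
  ; increasing = λ i j i<j → Equivalence.to (replaceAt-<⇔ toℕ (position E) i₀ q′ samePosition i j)
                                            (increasing E i j i<j)
  ; orderIso   = λ i j → replaceAt-<⇔ (value τ) (position E) i₀ q′ sameValue i j ⇔-∘ orderIso E i j
  }

-- An interval block, described by its set of positions, which is an interval both in
-- positions and in values; in this form it can be pulled back along occurrences.
record AvoidedBlock (σ : Perm k) (τ : Perm n) : Set₁ where
  field
    Inside          : Fin n → Set
    inside?         : Decidable Inside
    q q′            : Fin n
    q≢q′            : q ≢ q′
    q-inside        : Inside q
    q′-inside       : Inside q′
    position-convex : Convex toℕ Inside
    value-convex    : Convex (value τ) Inside
    avoided         : (occ : σ ≼ τ) → ∀ i → ¬ Inside (position occ i)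

hasIntervalBlock⇒avoidedBlock : ∀ {σ : Perm k} {τ : Perm n} → HasIntervalBlock σ τ → AvoidedBlock σ τ
hasIntervalBlock⇒avoidedBlock {τ = τ} (B , disjoint) = record
  { Inside          = Inside
  ; inside?         = λ p → (start B ℕ.≤? toℕ p) ×-dec (toℕ p ℕ.≤? start B ℕ.+ len B)
  ; q               = Fin.fromℕ< a<n
  ; q′              = Fin.fromℕ< 1+a<n
  ; q≢q′            = λ eq → ℕ.1+n≢n (trans (sym (Fin.toℕ-fromℕ< 1+a<n))
                                          (trans (cong toℕ (sym eq)) (Fin.toℕ-fromℕ< a<n)))
  ; q-inside        = subst (InBlock (start B) (len B)) (sym (Fin.toℕ-fromℕ< a<n)) (ℕ.≤-refl , ℕ.m≤m+n _ _)
  ; q′-inside       = subst (InBlock (start B) (len B)) (sym (Fin.toℕ-fromℕ< 1+a<n)) (ℕ.n≤1+n _ , 1+a≤a+b)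
  ; position-convex = λ (a≤i , _) (_ , j≤a+b) i<p p<j →
                        ℕ.≤-trans a≤i (ℕ.<⇒≤ i<p) , ℕ.≤-trans (ℕ.<⇒≤ p<j) j≤a+b
  ; value-convex    = value-convex
  ; avoided         = disjoint
  }
  where
  Inside : Fin _ → Set
  Inside p = InBlock (start B) (len B) (toℕ p)

  1+a≤a+b : suc (start B) ≤ start B ℕ.+ len B
  1+a≤a+b = subst (_≤ start B ℕ.+ len B) (ℕ.+-comm (start B) 1) (ℕ.+-monoʳ-≤ (start B) (len≥1 B))

  a<n : start B < _
  a<n = ℕ.≤-<-trans (ℕ.m≤m+n _ _) (fits B)

  1+a<n : suc (start B) < _
  1+a<n = ℕ.≤-<-trans 1+a≤a+b (fits B)

  -- The value of c lies in the value range of the block, and values determine positions.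
  value-convex : Convex (value τ) Inside
  value-convex {a} {b} {c} Ia Ib a<c c<b
    with p , Ip , p↦c ← valuesAll B (value τ c)
           ( ℕ.≤-trans (proj₁ (valuesIn B a Ia)) (ℕ.<⇒≤ a<c)
           , ℕ.≤-trans (ℕ.<⇒≤ c<b) (proj₂ (valuesIn B b Ib)))
    = subst Inside (value-injective τ p↦c) Ip

module _ {σ : Perm k} {x : Perm m} {τ : Perm n} (B : AvoidedBlock σ τ) (E : x ≼ τ) where
  open AvoidedBlock B

  avoidedBlock-pullback : ∀ {i j} → i ≢ j → Inside (position E i) → Inside (position E j) →
                          AvoidedBlock σ x
  avoidedBlock-pullback {i} {j} i≢j Ii Ij = record
    { Inside          = Inside ∘ position E
    ; inside?         = inside? ∘ position E
    ; q               = i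
    ; q′              = j
    ; q≢q′            = i≢j
    ; q-inside        = Ii
    ; q′-inside       = Ij
    ; position-convex = λ Ia Ib a<c c<b →
        position-convex Ia Ib (increasing E _ _ a<c) (increasing E _ _ c<b)
    ; value-convex    = λ Ia Ib a<c c<b →
        value-convex Ia Ib (Equivalence.to (orderIso E _ _) a<c) (Equivalence.to (orderIso E _ _) c<b)
    ; avoided         = λ occ → avoided (≼-trans occ E)
    }

-- An occurrence meeting the block in at most one letter can have that letter rerouted to q′,
-- which moves it off q.
module _ {σ : Perm k} {x : Perm m} {τ : Perm (suc n)} (B : AvoidedBlock σ τ) (E : x ≼ τ) where
  open AvoidedBlock B

  avoidedBlock-restrict : AvoidedBlock σ x ⊎ x ≼ delete τ q
  avoidedBlock-restrict with Fin.any? (λ i → inside? (position E i))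
  ... | no disjoint = inj₂ (≼-delete τ q E λ i e-i≡q → disjoint (i , subst Inside (sym e-i≡q) q-inside))
  ... | yes (i₀ , i₀-inside) with Fin.any? (λ j → ¬? (j Fin.≟ i₀) ×-dec inside? (position E j))
  ...   | yes (j , j≢i₀ , j-inside) = inj₁ (avoidedBlock-pullback B E (j≢i₀ ∘ sym) i₀-inside j-inside)
  ...   | no alone = inj₂ (≼-delete τ q rerouted rerouted-misses-q)
    where
    outside : ∀ j → j ≢ i₀ → ¬ Inside (position E j)
    outside j j≢i₀ j-inside = alone (j , j≢i₀ , j-inside)

    rerouted : x ≼ τ
    rerouted = reroute E i₀ q′
      (λ j j≢i₀ → convex-sameSide Fin.toℕ-injective position-convex i₀-inside q′-inside (outside j j≢i₀))
      (λ j j≢i₀ → convex-sameSide (value-injective τ) value-convex i₀-inside q′-inside (outside j j≢i₀))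

    rerouted-misses-q : ∀ i → position rerouted i ≢ q
    rerouted-misses-q i with i Fin.≟ i₀
    ... | yes _    = q≢q′ ∘ sym
    ... | no i≢i₀ = λ e-i≡q → outside i i≢i₀ (subst Inside (sym e-i≡q) q-inside)

module _ {μ : Elem → Elem → ℤ} (isMobius : IsMobius μ) where

  μ-closedInterval-sum : ∀ {s t} → s <𝒫 t → ∀ {L} → Unique L →
                         (∀ x → (x ∈ L) ⇔ ((s ≤𝒫 x) × (x ≤𝒫 t))) → sumMap (μ s) L ≡ 0ℤ
  μ-closedInterval-sum {s} {t} s<t {L} L-unique L-members = begin
    sumMap (μ s) L
      ≡⟨ sumMap-remove (μ s) elem-≟ L-unique t∈L ⟩
    μ s t + sumMap (μ s) L′
      ≡⟨ cong (_+ sumMap (μ s) L′) (proj₂ isMobius s t s<t L′ L′-enumerates) ⟩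
    - sumMap (μ s) L′ + sumMap (μ s) L′
      ≡⟨ ℤ.+-inverseˡ (sumMap (μ s) L′) ⟩
    0ℤ ∎
    where
    open ≡-Reasoning

    L′ : List Elem
    L′ = filter (λ x → ¬? (elem-≟ x t)) L

    t∈L : t ∈ L
    t∈L = Equivalence.from (L-members t) (proj₁ s<t , ≼-refl (perm t))

    L′-enumerates : EnumeratesHalfOpen s t L′
    L′-enumerates = Unique.filter⁺ _ L-unique , λ x → mk⇔
      (λ x∈L′ → let x∈L , x≢t = ∈.∈-filter⁻ _ x∈L′
                    s≤x , x≤t = Equivalence.to (L-members x) x∈L
                in s≤x , x≤t , x≢t)
      (λ (s≤x , x≤t , x≢t) → ∈.∈-filter⁺ _ (Equivalence.from (L-members x) (s≤x , x≤t)) x≢t)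

  module _ {k} (σ : Perm (suc k)) where

    VanishesAt : ℕ → Set₁
    VanishesAt n = (τ : Perm (suc n)) → σ ≼ τ → AvoidedBlock σ τ → μ ⟨ k , σ ⟩ ⟨ n , τ ⟩ ≡ 0ℤ

    module Split {m} (vanishes-below : ∀ {m′} → m′ < suc m → VanishesAt m′)
                 (τ : Perm (suc (suc m))) (σ≼τ : σ ≼ τ) (B : AvoidedBlock σ τ) where
      open AvoidedBlock B

      s t r : Elem
      s = ⟨ k , σ ⟩
      t = ⟨ suc m , τ ⟩
      r = ⟨ m , delete τ q ⟩

      σ≼τ-misses : ∀ {p} → Inside p → ∀ i → position σ≼τ i ≢ p
      σ≼τ-misses p-inside i e-i≡p = avoided σ≼τ i (subst Inside (sym e-i≡p) p-inside)

      -- Occurrences of σ in ρ also miss the position of ρ that q′ moves to.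
      s<r : s <𝒫 r
      s<r = σ≼ρ , ≼-missing⇒≢ σ≼ρ (punchOut q≢q′) λ i →
              σ≼τ-misses q′-inside i ∘ Fin.punchOut-injective _ q≢q′
        where
        σ≼ρ : σ ≼ delete τ q
        σ≼ρ = ≼-delete τ q σ≼τ (σ≼τ-misses q-inside)

      r<t : r <𝒫 t
      r<t = delete-≼ τ q , ℕ.1+n≢n ∘ sym ∘ cong size

      L : List Elem
      L = proj₁ (halfOpenInterval s t)

      L-enumerates : EnumeratesHalfOpen s t L
      L-enumerates = proj₂ (halfOpenInterval s t)

      below-r-sum : sumMap (μ s) (filter (_≤𝒫? r) L) ≡ 0ℤ
      below-r-sum = μ-closedInterval-sum s<r (Unique.filter⁺ _ (proj₁ L-enumerates)) λ x → mk⇔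
        (λ x∈ → let x∈L , x≤r = ∈.∈-filter⁻ _ x∈
                in proj₁ (Equivalence.to (proj₂ L-enumerates x) x∈L) , x≤r)
        (λ (s≤x , x≤r) → ∈.∈-filter⁺ _
          (Equivalence.from (proj₂ L-enumerates x) (s≤x , ≤𝒫-<𝒫-trans x≤r r<t)) x≤r)

      vanishes-not-below-r : ∀ {x} → s ≤𝒫 x → x <𝒫 t → ¬ (x ≤𝒫 r) → μ s x ≡ 0ℤ
      vanishes-not-below-r {⟨ a , π ⟩} s≤x x<t x≰r with avoidedBlock-restrict B (proj₁ x<t)
      ... | inj₁ B′  = vanishes-below (<𝒫⇒size< x<t) π s≤x B′
      ... | inj₂ x≤r = contradiction x≤r x≰r

      not-below-r-sum : sumMap (μ s) (filter (λ x → ¬? (x ≤𝒫? r)) L) ≡ 0ℤ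
      not-below-r-sum = sumMap-zero (μ s) (All.tabulate λ x∈ →
        let x∈L , x≰r = ∈.∈-filter⁻ _ x∈
            s≤x , x<t = Equivalence.to (proj₂ L-enumerates _) x∈L
        in vanishes-not-below-r s≤x x<t x≰r)

      μ≡0 : μ s t ≡ 0ℤ
      μ≡0 = begin
        μ s t
          ≡⟨ proj₂ isMobius s t (≤𝒫-<𝒫-trans (proj₁ s<r) r<t) L L-enumerates ⟩
        - sumMap (μ s) L
          ≡⟨ cong -_ (sumMap-filter (μ s) (_≤𝒫? r) L) ⟩
        - (sumMap (μ s) (filter (_≤𝒫? r) L) + sumMap (μ s) (filter (λ x → ¬? (x ≤𝒫? r)) L))
          ≡⟨ cong₂ (λ a b → - (a + b)) below-r-sum not-below-r-sum ⟩
        0ℤ ∎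
        where open ≡-Reasoning

    μ-vanishes : ∀ n → VanishesAt n
    μ-vanishes = <-rec VanishesAt vanishes
      where
      vanishes : ∀ n → (∀ {m} → m < n → VanishesAt m) → VanishesAt n
      vanishes zero _ _ _ B with AvoidedBlock.q B | AvoidedBlock.q′ B | AvoidedBlock.q≢q′ B
      ... | Fin.zero | Fin.zero | q≢q′ = contradiction refl q≢q′
      vanishes (suc m) vanishes-below τ σ≼τ B = Split.μ≡0 vanishes-below τ σ≼τ B

theorem3p2 : (μ : Elem → Elem → ℤ) → IsMobius μ →
    ∀ {k n : ℕ} (σ : Perm (suc k)) (τ : Perm (suc n)) → σ ≼ τ →
    HasIntervalBlock σ τ → μ ⟨ k , σ ⟩ ⟨ n , τ ⟩ ≡ pos 0
theorem3p2 μ isMobius σ τ σ≼τ hasBlock =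
  μ-vanishes isMobius σ _ τ σ≼τ (hasIntervalBlock⇒avoidedBlock hasBlock)
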